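{- Let $q$ be a prime power, $k\ge 3$, and let $\mathcal{A}$ be an arc of $\mathrm{PG}(k-1,q)$ of size $q+k-1-t$, with $t\ge 0$. For every $(k-2)$-subset $S$ of $\mathcal{A}$, let $f_S(X)$ be the product of $t$ linear forms in $X=(X_1,\dots,X_k)$ whose kernels are the $t$ hyperplanes meeting $\mathcal{A}$ in exactly $S$ (so $f_S$ is a homogeneous polynomial of degree $t$, determined up to a non-zero scalar factor, with one fixed choice made for each $S$). Fix a vector representative for each point of $\mathcal{A}$ and evaluate the $f_S$ at these representatives. Let $D$ be a subset of $\mathcal{A}$ of size $k-3$. Then for all $x,y,z\in\mathcal{A}\setminus D$, $$ f_{D\cup\{x\}}(y)\,f_{D\cup\{y\}}(z)\,f_{D\cup\{z\}}(x)=(-1)^{t+1}\,f_{D\cup\{y\}}(x)\,f_{D\cup\{z\}}(y)\,f_{D\cup\{x\}}(z). $$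
   Context: An arc of $\mathrm{PG}(k-1,q)$ is a set of points any $k$ of which span the whole space. For an arc of size $q+k-1-t$ and any $(k-2)$-subset $S$ of it, there are exactly $t$ hyperplanes of $\mathrm{PG}(k-1,q)$ whose intersection with the arc is precisely $S$; these are the hyperplanes used to define $f_S$. -}

module Defs where

open import Level using (Level; _⊔_) renaming (suc to lsuc)
open import Algebra.Bundles using (CommutativeRing)
open import Data.Nat using (ℕ; zero; suc; _^_)
open import Data.Nat.Primality using (Prime)
open import Data.Fin using (Fin; zero; suc)
open import Data.Fin.Subset using (Subset; _∈_)
open import Data.Product using (Σ; ∃; ∃₂; _×_; _,_)
open import Function using (_∘_)
open import Function.Definitions using (Injective)
open import Relation.Nullary using (¬_)
open import Relation.Binary.PropositionalEquality using (_≡_)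

record Field c ℓ : Set (lsuc (c ⊔ ℓ)) where
  field
    commutativeRing : CommutativeRing c ℓ
  open CommutativeRing commutativeRing public
  field
    0≉1     : ¬ (0# ≈ 1#)
    inverse : ∀ x → ¬ (x ≈ 0#) → ∃ λ y → x * y ≈ 1#

PrimePower : ℕ → Set
PrimePower q = ∃₂ λ p e → Prime p × q ≡ p ^ suc e

module FieldDefs {c ℓ} (F : Field c ℓ) where
  open Field F using (Carrier; _≈_; _+_; _*_; -_; 0#; 1#)

  HasCard : ℕ → Set (c ⊔ ℓ)
  HasCard q = Σ (Fin q → Carrier) λ e →
                (∀ i j → e i ≈ e j → i ≡ j) × (∀ a → ∃ λ i → e i ≈ a)

  Vect : ℕ → Set c
  Vect k = Fin k → Carrier

  sumF : ∀ {n} → (Fin n → Carrier) → Carrier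
  sumF {zero}  f = 0#
  sumF {suc n} f = f zero + sumF (f ∘ suc)

  prodF : ∀ {n} → (Fin n → Carrier) → Carrier
  prodF {zero}  f = 1#
  prodF {suc n} f = f zero * prodF (f ∘ suc)

  -- evaluation of the linear form with coefficient vector u at v
  dot : ∀ {k} → Vect k → Vect k → Carrier
  dot u v = sumF (λ i → u i * v i)

  NonZero : ∀ {k} → Vect k → Set ℓ
  NonZero v = ¬ (∀ i → v i ≈ 0#)

  LinIndep : ∀ {m k} → (Fin m → Vect k) → Set (c ⊔ ℓ)
  LinIndep vs = ∀ (cs : Fin _ → Carrier) →
                (∀ i → sumF (λ j → cs j * vs j i) ≈ 0#) → ∀ j → cs j ≈ 0#

  -- a (Fin n)-indexed family of vector representatives of points of
  -- PG(k-1,q) is an arc: any k distinct members are linearly independent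
  -- (i.e. span the whole space).  (For k ≥ 2 this forces them non-zero
  -- and pairwise non-proportional, i.e. n distinct points.)
  IsArc : ∀ {n k} → (Fin n → Vect k) → Set (c ⊔ ℓ)
  IsArc {n} {k} a = ∀ (σ : Fin k → Fin n) → Injective _≡_ _≡_ σ → LinIndep (a ∘ σ)

  SameHyperplane : ∀ {k} → Vect k → Vect k → Set (c ⊔ ℓ)
  SameHyperplane u w = ∀ v → (dot u v ≈ 0# → dot w v ≈ 0#) × (dot w v ≈ 0# → dot u v ≈ 0#)

  MeetsExactly : ∀ {n k} → Vect k → (Fin n → Vect k) → Subset n → Set ℓ
  MeetsExactly u a S = ∀ i → (dot u (a i) ≈ 0# → i ∈ S) × (i ∈ S → dot u (a i) ≈ 0#)

  TangentForms : ∀ {n k t} → (Fin n → Vect k) → Subset n → (Fin t → Vect k) → Set (c ⊔ ℓ)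
  TangentForms a S L =
      (∀ j → NonZero (L j))
    × (∀ j → MeetsExactly (L j) a S)
    × (∀ j j′ → SameHyperplane (L j) (L j′) → j ≡ j′)
    × (∀ u → NonZero u → MeetsExactly u a S → ∃ λ j → SameHyperplane u (L j))

  fS : ∀ {k t} → (Fin t → Vect k) → Vect k → Carrier
  fS L v = prodF (λ j → dot (L j) v)

  negOnePow : ℕ → Carrier
  negOnePow zero    = 1#
  negOnePow (suc m) = - 1# * negOnePow m

module Submission where

-- For distinct x, y, z outside D the k points D ∪ {x,y,z} form a basis.  In
-- each cyclic role (p, r, s) of (x, y, z), every tangent form u of S = D ∪ {p}
-- vanishes on p and D, so u(v) = c_r(v) u(r) + c_s(v) u(s) in coordinates.
-- The t tangent ratios λ_u = u(s)/u(r) satisfy f_S(s) = (∏ λ_u) f_S(r); each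
-- of the m = n - k remaining arc points w gives a secant ratio
-- ρ_w = -c_r(w)/c_s(w).  The arc and tangent properties make these t + m =
-- q - 1 scalars distinct and non-zero, so Wilson's theorem gives
-- (∏ λ)(∏ ρ) = -1.  The three roles' ρ_w multiply to -1 and (-1)^(q-1) = 1,
-- which yields the identity.  Coinciding points make both sides vanish; for
-- t = 0 the distinct case itself says 1 = -1.

open import Defs
open import Level using (_⊔_)
open import Data.Nat using (ℕ; zero; suc; _∸_; _≤_; _<_; s≤s)
open import Data.Nat using () renaming (_+_ to _+ℕ_)
import Data.Nat.Properties as ℕP
open import Data.Nat.Tactic.RingSolver using (solve-∀)
open import Data.Fin using (Fin; zero; suc; punchIn; punchOut)
import Data.Fin.Properties as FinP
open import Data.Fin.Patterns using (0F; 1F; 2F; 3F; 4F; 5F; 6F)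
open import Data.Fin.Subset using (Subset; _∈_; _∉_; _∪_; ⁅_⁆; ∣_∣; ∁; inside; outside)
open import Data.Fin.Subset.Properties
  using (x∈⁅x⁆; x∈⁅y⁆⇒x≡y; x∈p∪q⁻; x∈p∪q⁺; x∈∁p⇒x∉p; ∣∁p∣≡n∸∣p∣; ∪-identityʳ)
open import Data.Vec.Base using ([]; _∷_; here; there)
open import Data.Vec.Functional using () renaming (_∷_ to _∷ᶠ_)
open import Data.List using (List; []; _∷_; length; foldr; tabulate)
import Data.List.Membership.Setoid as ListMembership
open import Data.List.Membership.Setoid.Properties using (∈-resp-≈; ∈-tabulate⁺; ∈-tabulate⁻)
open import Data.List.Relation.Unary.Any using (here; there)
open import Data.Product using (Σ; ∃; _×_; _,_; proj₁; proj₂)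
open import Data.Sum using (_⊎_; inj₁; inj₂; [_,_]′)
open import Data.Empty using (⊥; ⊥-elim)
open import Data.Unit.Polymorphic using (⊤)
open import Function using (_∘_)
open import Function.Definitions using (Injective)
open import Relation.Nullary using (¬_; yes; no; ¬?)
open import Relation.Binary.Definitions using (Decidable)
open import Relation.Binary.PropositionalEquality as ≡ using (_≡_; _≢_)
import Algebra.Properties.CommutativeSemigroup as CommutativeSemigroupProperties
import Algebra.Solver.CommutativeMonoid as CommutativeMonoidSolver
import Algebra.Properties.Ring as RingProperties
import Algebra.Properties.Group as GroupProperties
import Relation.Binary.Reasoning.Setoid as SetoidReasoning

module FieldFacts {c ℓ} (F : Field c ℓ) (_≟_ : Decidable (Field._≈_ F)) where
  open Field F hiding (zero)
  open FieldDefs F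
  open SetoidReasoning setoid public
  open RingProperties ring public using (-‿distribˡ-*; -‿distribʳ-*; -1*x≈-x)
  module AdditiveGroup = GroupProperties +-group
  module Add = CommutativeSemigroupProperties +-commutativeSemigroup
  module Mul = CommutativeSemigroupProperties *-commutativeSemigroup

  NZ : Carrier → Set ℓ
  NZ x = ¬ (x ≈ 0#)

  -- the inverse, extended by inv 0 = 0
  inv : Carrier → Carrier
  inv x with x ≟ 0#
  ... | yes _ = 0#
  ... | no x≉0 = proj₁ (inverse x x≉0)

  inv-r : ∀ {x} → NZ x → x * inv x ≈ 1#
  inv-r {x} x≉0 with x ≟ 0#
  ... | yes x≈0 = ⊥-elim (x≉0 x≈0)
  ... | no x≉0′ = proj₂ (inverse x x≉0′)

  inv-l : ∀ {x} → NZ x → inv x * x ≈ 1#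
  inv-l {x} x≉0 = trans (*-comm (inv x) x) (inv-r x≉0)

  1≉0 : NZ 1#
  1≉0 1≈0 = 0≉1 (sym 1≈0)

  unit-nz : ∀ {x y} → x * y ≈ 1# → NZ x
  unit-nz {x} {y} xy≈1 x≈0 = 1≉0 (trans (sym xy≈1) (trans (*-congʳ x≈0) (zeroˡ y)))

  inv-nz : ∀ {x} → NZ x → NZ (inv x)
  inv-nz x≉0 = unit-nz (inv-l x≉0)

  cancelˡ : ∀ {x a b} → NZ x → x * a ≈ x * b → a ≈ b
  cancelˡ {x} {a} {b} x≉0 xa≈xb = begin
    a                ≈⟨ unmul a ⟨
    inv x * (x * a)  ≈⟨ *-congˡ xa≈xb ⟩
    inv x * (x * b)  ≈⟨ unmul b ⟩
    b                ∎
    where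
    unmul : ∀ a → inv x * (x * a) ≈ a
    unmul a = trans (sym (*-assoc _ _ _)) (trans (*-congʳ (inv-l x≉0)) (*-identityˡ a))

  div-mul : ∀ {a y} → NZ y → (a * inv y) * y ≈ a
  div-mul {a} y≉0 = trans (*-assoc _ _ _) (trans (*-congˡ (inv-l y≉0)) (*-identityʳ a))

  cancel-middle : ∀ {x y z} → NZ y → (x * inv y) * (y * z) ≈ x * z
  cancel-middle {x} {y} {z} y≉0 = begin
    (x * inv y) * (y * z)   ≈⟨ *-assoc x (inv y) (y * z) ⟩
    x * (inv y * (y * z))   ≈⟨ *-congˡ (*-assoc (inv y) y z) ⟨
    x * ((inv y * y) * z)   ≈⟨ *-congˡ (*-congʳ (inv-l y≉0)) ⟩
    x * (1# * z)            ≈⟨ *-congˡ (*-identityˡ z) ⟩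
    x * z                   ∎

  nz-* : ∀ {x y} → NZ x → NZ y → NZ (x * y)
  nz-* {x} x≉0 y≉0 xy≈0 = y≉0 (cancelˡ x≉0 (trans xy≈0 (sym (zeroʳ x))))

  zero-product : ∀ {x y} → x * y ≈ 0# → x ≈ 0# ⊎ y ≈ 0#
  zero-product {x} xy≈0 with x ≟ 0#
  ... | yes x≈0 = inj₁ x≈0
  ... | no x≉0 = inj₂ (cancelˡ x≉0 (trans xy≈0 (sym (zeroʳ x))))

  inv-unique : ∀ {x y} → x * y ≈ 1# → y ≈ inv x
  inv-unique xy≈1 = cancelˡ (unit-nz xy≈1) (trans xy≈1 (sym (inv-r (unit-nz xy≈1))))

  inv-involutive : ∀ {x} → NZ x → inv (inv x) ≈ x
  inv-involutive x≉0 = sym (inv-unique (inv-l x≉0))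

  inv-flip : ∀ {b c} → NZ b → inv b ≈ c → b ≈ inv c
  inv-flip b≉0 invb≈c = inv-unique (trans (*-congʳ (sym invb≈c)) (inv-l b≉0))

  neg-nz : ∀ {x} → NZ x → NZ (- x)
  neg-nz {x} x≉0 -x≈0 =
    x≉0 (trans (sym (AdditiveGroup.⁻¹-involutive x)) (trans (-‿cong -x≈0) AdditiveGroup.ε⁻¹≈ε))

  -1²≈1 : - 1# * - 1# ≈ 1#
  -1²≈1 = trans (-1*x≈-x (- 1#)) (AdditiveGroup.⁻¹-involutive 1#)

  ratio-cycle : ∀ {α β γ} → NZ α → NZ β → NZ γ →
                - (β * inv γ) * (- (γ * inv α) * - (α * inv β)) ≈ - 1#
  ratio-cycle {α} {β} {γ} α≉0 β≉0 γ≉0 = begin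
    - (β * inv γ) * (- (γ * inv α) * - (α * inv β))  ≈⟨ *-congˡ (neg-*-neg _ _) ⟩
    - (β * inv γ) * ((γ * inv α) * (α * inv β))      ≈⟨ *-congˡ (cancel-middle α≉0) ⟩
    - (β * inv γ) * (γ * inv β)                      ≈⟨ -‿distribˡ-* _ _ ⟨
    - ((β * inv γ) * (γ * inv β))                    ≈⟨ -‿cong (cancel-middle γ≉0) ⟩
    - (β * inv β)                                    ≈⟨ -‿cong (inv-r β≉0) ⟩
    - 1#                                             ∎
    where
    neg-*-neg : ∀ x y → - x * - y ≈ x * y
    neg-*-neg x y = trans (sym (-‿distribˡ-* x (- y)))
      (trans (-‿cong (sym (-‿distribʳ-* x y))) (AdditiveGroup.⁻¹-involutive _))

  -- the only square roots of 1 are 1 and -1, as (x - 1)(x + 1) = x² - 1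
  square-root-of-1 : ∀ {x} → x * x ≈ 1# → x ≈ 1# ⊎ x ≈ - 1#
  square-root-of-1 {x} x²≈1 with zero-product factored
    where
    factored : (x + - 1#) * (x + 1#) ≈ 0#
    factored = begin
      (x + - 1#) * (x + 1#)          ≈⟨ distribʳ (x + 1#) x (- 1#) ⟩
      x * (x + 1#) + - 1# * (x + 1#) ≈⟨ +-cong (distribˡ x x 1#) (-1*x≈-x (x + 1#)) ⟩
      (x * x + x * 1#) + - (x + 1#)  ≈⟨ +-congʳ (+-cong x²≈1 (*-identityʳ x)) ⟩
      (1# + x) + - (x + 1#)          ≈⟨ +-congʳ (+-comm 1# x) ⟩
      (x + 1#) + - (x + 1#)          ≈⟨ -‿inverseʳ (x + 1#) ⟩
      0#                             ∎
  ... | inj₁ x-1≈0 = inj₁ (AdditiveGroup.x∙y⁻¹≈ε⇒x≈y x 1# x-1≈0)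
  ... | inj₂ x+1≈0 = inj₂ (AdditiveGroup.inverseʳ-unique 1# x (trans (+-comm 1# x) x+1≈0))

  product₃-zero : ∀ {x y z} → x ≈ 0# ⊎ y ≈ 0# ⊎ z ≈ 0# → (x * y) * z ≈ 0#
  product₃-zero {x} {y} {z} (inj₁ x≈0) = trans (*-congʳ (trans (*-congʳ x≈0) (zeroˡ y))) (zeroˡ z)
  product₃-zero {x} {y} {z} (inj₂ (inj₁ y≈0)) = trans (*-congʳ (trans (*-congˡ y≈0) (zeroʳ x))) (zeroˡ z)
  product₃-zero {x} {y} {z} (inj₂ (inj₂ z≈0)) = trans (*-congˡ z≈0) (zeroʳ (x * y))

  sumF-cong : ∀ {n} {f g : Fin n → Carrier} → (∀ i → f i ≈ g i) → sumF f ≈ sumF g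
  sumF-cong {zero} f≈g = refl
  sumF-cong {suc n} f≈g = +-cong (f≈g zero) (sumF-cong (f≈g ∘ suc))

  sumF-0 : ∀ {n} (f : Fin n → Carrier) → (∀ i → f i ≈ 0#) → sumF f ≈ 0#
  sumF-0 {zero} f f≈0 = refl
  sumF-0 {suc n} f f≈0 = trans (+-cong (f≈0 zero) (sumF-0 (f ∘ suc) (f≈0 ∘ suc))) (+-identityˡ 0#)

  sumF-+ : ∀ {n} (f g : Fin n → Carrier) → sumF (λ i → f i + g i) ≈ sumF f + sumF g
  sumF-+ {zero} f g = sym (+-identityˡ 0#)
  sumF-+ {suc n} f g = trans (+-congˡ (sumF-+ (f ∘ suc) (g ∘ suc)))
    (Add.interchange _ _ _ _)

  sumF-* : ∀ {n} (a : Carrier) (f : Fin n → Carrier) → sumF (λ i → a * f i) ≈ a * sumF f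
  sumF-* {zero} a f = sym (zeroʳ a)
  sumF-* {suc n} a f = trans (+-congˡ (sumF-* a (f ∘ suc))) (sym (distribˡ a _ _))

  sumF-neg : ∀ {n} (f : Fin n → Carrier) → sumF (λ i → - f i) ≈ - sumF f
  sumF-neg f = begin
    sumF (λ i → - f i)      ≈⟨ sumF-cong (λ i → -1*x≈-x (f i)) ⟨
    sumF (λ i → - 1# * f i) ≈⟨ sumF-* (- 1#) f ⟩
    - 1# * sumF f           ≈⟨ -1*x≈-x _ ⟩
    - sumF f                ∎

  sumF-swap : ∀ {m n} (f : Fin m → Fin n → Carrier) →
              sumF (λ i → sumF (λ j → f i j)) ≈ sumF (λ j → sumF (λ i → f i j))
  sumF-swap {zero} {n} f = sym (sumF-0 {n} (λ j → 0#) (λ _ → refl))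
  sumF-swap {suc m} {n} f = trans (+-congˡ (sumF-swap (f ∘ suc)))
    (sym (sumF-+ (f zero) (λ j → sumF (λ i → f (suc i) j))))

  sumF-punch : ∀ {n} (p : Fin (suc n)) (f : Fin (suc n) → Carrier) →
               sumF f ≈ f p + sumF (f ∘ punchIn p)
  sumF-punch zero f = refl
  sumF-punch {suc n} (suc p) f = trans (+-congˡ (sumF-punch p (f ∘ suc)))
    (Add.x∙yz≈y∙xz _ _ _)

  prodF-cong : ∀ {n} {f g : Fin n → Carrier} → (∀ i → f i ≈ g i) → prodF f ≈ prodF g
  prodF-cong {zero} f≈g = refl
  prodF-cong {suc n} f≈g = *-cong (f≈g zero) (prodF-cong (f≈g ∘ suc))

  prodF-* : ∀ {n} (f g : Fin n → Carrier) → prodF (λ i → f i * g i) ≈ prodF f * prodF g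
  prodF-* {zero} f g = sym (*-identityˡ 1#)
  prodF-* {suc n} f g = trans (*-congˡ (prodF-* (f ∘ suc) (g ∘ suc)))
    (Mul.interchange _ _ _ _)

  prodF-zero : ∀ {n} (f : Fin n → Carrier) (i : Fin n) → f i ≈ 0# → prodF f ≈ 0#
  prodF-zero f zero fi≈0 = trans (*-congʳ fi≈0) (zeroˡ _)
  prodF-zero f (suc i) fi≈0 = trans (*-congˡ (prodF-zero (f ∘ suc) i fi≈0)) (zeroʳ _)

  prodF-const-1 : ∀ n → prodF {n} (λ _ → - 1#) ≈ negOnePow n
  prodF-const-1 zero = refl
  prodF-const-1 (suc n) = *-congˡ (prodF-const-1 n)

  prodF-neg : ∀ {n} (f : Fin n → Carrier) → prodF (λ i → - f i) ≈ negOnePow n * prodF f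
  prodF-neg {n} f = begin
    prodF (λ i → - f i)                  ≈⟨ prodF-cong (λ i → -1*x≈-x (f i)) ⟨
    prodF (λ i → - 1# * f i)             ≈⟨ prodF-* (λ _ → - 1#) f ⟩
    prodF {n} (λ _ → - 1#) * prodF f     ≈⟨ *-congʳ (prodF-const-1 n) ⟩
    negOnePow n * prodF f                ∎

  negOnePow-+ : ∀ a b → negOnePow (a +ℕ b) ≈ negOnePow a * negOnePow b
  negOnePow-+ zero b = sym (*-identityˡ _)
  negOnePow-+ (suc a) b = trans (*-congˡ (negOnePow-+ a b)) (sym (*-assoc _ _ _))

  negOnePow-square : ∀ a → negOnePow a * negOnePow a ≈ 1#
  negOnePow-square zero = *-identityˡ 1#
  negOnePow-square (suc a) = begin
    (- 1# * negOnePow a) * (- 1# * negOnePow a)  ≈⟨ Mul.interchange _ _ _ _ ⟩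
    (- 1# * - 1#) * (negOnePow a * negOnePow a)  ≈⟨ *-cong -1²≈1 (negOnePow-square a) ⟩
    1# * 1#                                      ≈⟨ *-identityˡ 1# ⟩
    1#                                           ∎

  append : ∀ {a b} → (Fin a → Carrier) → (Fin b → Carrier) → Fin (a +ℕ b) → Carrier
  append {zero} f g i = g i
  append {suc a} f g zero = f zero
  append {suc a} f g (suc i) = append (f ∘ suc) g i

  prodF-append : ∀ {a b} (f : Fin a → Carrier) (g : Fin b → Carrier) →
                 prodF (append f g) ≈ prodF f * prodF g
  prodF-append {zero} f g = sym (*-identityˡ _)
  prodF-append {suc a} f g = trans (*-congˡ (prodF-append (f ∘ suc) g)) (sym (*-assoc _ _ _))

  append-view : ∀ {a b} (f : Fin a → Carrier) (g : Fin b → Carrier) (i : Fin (a +ℕ b)) →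
                (∃ λ j → append f g i ≡ f j) ⊎ (∃ λ j → append f g i ≡ g j)
  append-view {zero} f g i = inj₂ (i , ≡.refl)
  append-view {suc a} f g zero = inj₁ (zero , ≡.refl)
  append-view {suc a} f g (suc i) with append-view (f ∘ suc) g i
  ... | inj₁ (j , eq) = inj₁ (suc j , eq)
  ... | inj₂ (j , eq) = inj₂ (j , eq)

  InjF : ∀ {a} → (Fin a → Carrier) → Set ℓ
  InjF f = ∀ i j → f i ≈ f j → i ≡ j

  append-inj : ∀ {a b} (f : Fin a → Carrier) (g : Fin b → Carrier) →
               InjF f → InjF g → (∀ i j → ¬ (f i ≈ g j)) → InjF (append f g)
  append-inj {zero} f g f-inj g-inj disjoint = g-inj
  append-inj {suc a} f g f-inj g-inj disjoint zero zero _ = ≡.refl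
  append-inj {suc a} f g f-inj g-inj disjoint zero (suc j) eq with append-view (f ∘ suc) g j
  ... | inj₁ (j′ , e) with f-inj zero (suc j′) (trans eq (reflexive e))
  ...   | ()
  append-inj {suc a} f g f-inj g-inj disjoint zero (suc j) eq | inj₂ (j′ , e) =
    ⊥-elim (disjoint zero j′ (trans eq (reflexive e)))
  append-inj {suc a} f g f-inj g-inj disjoint (suc i) zero eq =
    ≡.sym (append-inj f g f-inj g-inj disjoint zero (suc i) (sym eq))
  append-inj {suc a} f g f-inj g-inj disjoint (suc i) (suc j) eq =
    ≡.cong suc (append-inj (f ∘ suc) g (λ i j e → FinP.suc-injective (f-inj (suc i) (suc j) e))
                           g-inj (λ i → disjoint (suc i)) i j eq)

  append-nz : ∀ {a b} (f : Fin a → Carrier) (g : Fin b → Carrier) →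
              (∀ i → NZ (f i)) → (∀ i → NZ (g i)) → ∀ i → NZ (append f g i)
  append-nz f g f≉0 g≉0 i with append-view f g i
  ... | inj₁ (j , eq) = λ ≈0 → f≉0 j (trans (sym (reflexive eq)) ≈0)
  ... | inj₂ (j , eq) = λ ≈0 → g≉0 j (trans (sym (reflexive eq)) ≈0)

-- Wilson's theorem for a finite field with q elements: any q - 1 distinct
-- non-zero elements multiply to -1 (each element pairs off with its inverse;
-- only 1 and -1 are self-inverse).  As a consequence (-1)^(q-1) = 1.
module Wilson {c ℓ} (F : Field c ℓ) (_≟_ : Decidable (Field._≈_ F))
              (q : ℕ) (card : FieldDefs.HasCard F q) where
  open Field F hiding (zero)
  open FieldDefs F
  open FieldFacts F _≟_
  open ListMembership setoid using () renaming (_∈_ to _∈ₗ_; _∉_ to _∉ₗ_)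

  prodL : List Carrier → Carrier
  prodL = foldr _*_ 1#

  Distinct : List Carrier → Set (c ⊔ ℓ)
  Distinct [] = ⊤
  Distinct (x ∷ xs) = x ∉ₗ xs × Distinct xs

  remove : ∀ {a xs} → a ∈ₗ xs → List Carrier
  remove {xs = x ∷ xs} (here _) = xs
  remove {xs = x ∷ xs} (there a∈xs) = x ∷ remove a∈xs

  remove-prod : ∀ {a xs} (a∈xs : a ∈ₗ xs) → prodL xs ≈ a * prodL (remove a∈xs)
  remove-prod (here a≈x) = *-congʳ (sym a≈x)
  remove-prod {a} {x ∷ xs} (there a∈xs) = trans (*-congˡ (remove-prod a∈xs))
    (Mul.x∙yz≈y∙xz x a _)

  remove-⊆ : ∀ {a b xs} (a∈xs : a ∈ₗ xs) → b ∈ₗ remove a∈xs → b ∈ₗ xs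
  remove-⊆ (here _) b∈ = there b∈
  remove-⊆ (there a∈xs) (here b≈x) = here b≈x
  remove-⊆ (there a∈xs) (there b∈) = there (remove-⊆ a∈xs b∈)

  remove-keeps : ∀ {a b xs} (a∈xs : a ∈ₗ xs) → b ∈ₗ xs → ¬ b ≈ a → b ∈ₗ remove a∈xs
  remove-keeps (here a≈x) (here b≈x) b≉a = ⊥-elim (b≉a (trans b≈x (sym a≈x)))
  remove-keeps (here _) (there b∈) b≉a = b∈
  remove-keeps (there a∈xs) (here b≈x) b≉a = here b≈x
  remove-keeps (there a∈xs) (there b∈) b≉a = there (remove-keeps a∈xs b∈ b≉a)

  remove-distinct : ∀ {a xs} (a∈xs : a ∈ₗ xs) → Distinct xs → Distinct (remove a∈xs)
  remove-distinct (here _) (_ , d) = d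
  remove-distinct (there a∈xs) (x∉ , d) = (x∉ ∘ remove-⊆ a∈xs) , remove-distinct a∈xs d

  remove-removes : ∀ {a xs} (a∈xs : a ∈ₗ xs) → Distinct xs → a ∉ₗ remove a∈xs
  remove-removes (here a≈x) (x∉ , _) a∈ = x∉ (∈-resp-≈ setoid a≈x a∈)
  remove-removes (there a∈xs) (x∉ , _) (here a≈x) = x∉ (∈-resp-≈ setoid a≈x a∈xs)
  remove-removes (there a∈xs) (_ , d) (there a∈) = remove-removes a∈xs d a∈

  remove-length : ∀ {a xs} (a∈xs : a ∈ₗ xs) → length xs ≡ suc (length (remove a∈xs))
  remove-length (here _) = ≡.refl
  remove-length (there a∈xs) = ≡.cong suc (remove-length a∈xs)

  NoSelfInverse : List Carrier → Set (c ⊔ ℓ)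
  NoSelfInverse xs = ∀ b → b ∈ₗ xs → NZ b × ¬ b ≈ 1# × ¬ b ≈ - 1#

  InverseClosed : List Carrier → Set (c ⊔ ℓ)
  InverseClosed xs = ∀ b → b ∈ₗ xs → inv b ∈ₗ xs

  -- such a list splits into pairs {b, b⁻¹}, so its product is 1
  -- (induction on a bound for the length)
  pairing : ∀ bound xs → length xs ≤ bound → Distinct xs → NoSelfInverse xs →
            InverseClosed xs → prodL xs ≈ 1#
  pairing bound [] _ _ _ _ = refl
  pairing (suc bound) (h ∷ xs) (s≤s len) (h∉ , d) good closed
    with good h (here refl) | closed h (here refl)
  ... | h≉0 , h≉1 , h≉-1 | here invh≈h =
    ⊥-elim ([ h≉1 , h≉-1 ]′ (square-root-of-1 (trans (*-congˡ (sym invh≈h)) (inv-r h≉0))))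
  ... | h≉0 , _ , _ | there invh∈xs = begin
      h * prodL xs                 ≈⟨ *-congˡ (remove-prod invh∈xs) ⟩
      h * (inv h * prodL xs′)      ≈⟨ *-assoc _ _ _ ⟨
      (h * inv h) * prodL xs′      ≈⟨ *-congʳ (inv-r h≉0) ⟩
      1# * prodL xs′               ≈⟨ *-identityˡ _ ⟩
      prodL xs′                    ≈⟨ pairing bound xs′ len′ (remove-distinct invh∈xs d) good′ closed′ ⟩
      1#                           ∎
    where
    xs′ : List Carrier
    xs′ = remove invh∈xs
    len′ : length xs′ ≤ bound
    len′ = ℕP.≤-trans (ℕP.n≤1+n _) (≡.subst (_≤ bound) (remove-length invh∈xs) len)
    good′ : NoSelfInverse xs′
    good′ b b∈ = good b (there (remove-⊆ invh∈xs b∈))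
    closed′ : InverseClosed xs′
    closed′ b b∈ with closed b (there (remove-⊆ invh∈xs b∈))
    ... | here invb≈h = ⊥-elim (remove-removes invh∈xs d
                          (∈-resp-≈ setoid (inv-flip (proj₁ (good′ b b∈)) invb≈h) b∈))
    ... | there invb∈xs = remove-keeps invh∈xs invb∈xs invb≉invh
      where
      invb≉invh : ¬ inv b ≈ inv h
      invb≉invh invb≈invh = h∉ (∈-resp-≈ setoid
        (trans (inv-flip (proj₁ (good′ b b∈)) invb≈invh) (inv-involutive h≉0)) (remove-⊆ invh∈xs b∈))

  product-without-±1 : ∀ ys → Distinct ys → NoSelfInverse ys →
                       (∀ b → NZ b → ¬ b ≈ 1# → ¬ b ≈ - 1# → b ∈ₗ ys) → prodL ys ≈ 1#
  product-without-±1 ys d good complete = pairing _ ys ℕP.≤-refl d good closed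
    where
    closed : InverseClosed ys
    closed b b∈ with good b b∈
    ... | b≉0 , b≉1 , b≉-1 = complete (inv b) (inv-nz b≉0)
      (λ invb≈1 → b≉1 (trans (inv-flip b≉0 invb≈1) inv-1))
      (λ invb≈-1 → b≉-1 (trans (inv-flip b≉0 invb≈-1) inv--1))
      where
      inv-1 : inv 1# ≈ 1#
      inv-1 = sym (inv-unique (*-identityˡ 1#))
      inv--1 : inv (- 1#) ≈ - 1#
      inv--1 = sym (inv-unique -1²≈1)

  wilson-list : ∀ xs → Distinct xs → (∀ b → b ∈ₗ xs → NZ b) → (∀ b → NZ b → b ∈ₗ xs) →
                prodL xs ≈ - 1#
  wilson-list xs d nonzero complete with 1# ≟ (- 1#)
  ... | yes 1≈-1 = begin
      prodL xs         ≈⟨ remove-prod 1∈xs ⟩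
      1# * prodL ys    ≈⟨ *-identityˡ _ ⟩
      prodL ys         ≈⟨ product-without-±1 ys (remove-distinct 1∈xs d) good (λ b b≉0 b≉1 _ → remove-keeps 1∈xs (complete b b≉0) b≉1) ⟩
      1#               ≈⟨ 1≈-1 ⟩
      - 1#             ∎
    where
    1∈xs : 1# ∈ₗ xs
    1∈xs = complete 1# 1≉0
    ys : List Carrier
    ys = remove 1∈xs
    b≉1 : ∀ b → b ∈ₗ ys → ¬ b ≈ 1#
    b≉1 b b∈ b≈1 = remove-removes 1∈xs d (∈-resp-≈ setoid b≈1 b∈)
    good : NoSelfInverse ys
    good b b∈ = nonzero b (remove-⊆ 1∈xs b∈) , b≉1 b b∈ , (λ b≈-1 → b≉1 b b∈ (trans b≈-1 (sym 1≈-1)))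
  ... | no 1≉-1 = begin
      prodL xs                  ≈⟨ remove-prod 1∈xs ⟩
      1# * prodL xs′            ≈⟨ *-identityˡ _ ⟩
      prodL xs′                 ≈⟨ remove-prod -1∈xs′ ⟩
      - 1# * prodL ys           ≈⟨ *-congˡ (product-without-±1 ys (remove-distinct -1∈xs′ d′) good complete′) ⟩
      - 1# * 1#                 ≈⟨ *-identityʳ _ ⟩
      - 1#                      ∎
    where
    1∈xs : 1# ∈ₗ xs
    1∈xs = complete 1# 1≉0
    xs′ : List Carrier
    xs′ = remove 1∈xs
    d′ : Distinct xs′
    d′ = remove-distinct 1∈xs d
    -1∈xs′ : - 1# ∈ₗ xs′
    -1∈xs′ = remove-keeps 1∈xs (complete (- 1#) (neg-nz 1≉0)) (1≉-1 ∘ sym)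
    ys : List Carrier
    ys = remove -1∈xs′
    good : NoSelfInverse ys
    good b b∈ = nonzero b (remove-⊆ 1∈xs (remove-⊆ -1∈xs′ b∈))
              , (λ b≈1 → remove-removes 1∈xs d (∈-resp-≈ setoid b≈1 (remove-⊆ -1∈xs′ b∈)))
              , (λ b≈-1 → remove-removes -1∈xs′ d′ (∈-resp-≈ setoid b≈-1 b∈))
    complete′ : ∀ b → NZ b → ¬ b ≈ 1# → ¬ b ≈ - 1# → b ∈ₗ ys
    complete′ b b≉0 b≉1 b≉-1 = remove-keeps -1∈xs′ (remove-keeps 1∈xs (complete b b≉0) b≉1) b≉-1

  element : Fin q → Carrier
  element = proj₁ card

  element-inj : ∀ i j → element i ≈ element j → i ≡ j
  element-inj = proj₁ (proj₂ card)

  index : Carrier → Fin q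
  index b = proj₁ (proj₂ (proj₂ card) b)

  element-index : ∀ b → element (index b) ≈ b
  element-index b = proj₂ (proj₂ (proj₂ card) b)

  -- pigeonhole: an injective family of q - 1 non-zero elements hits every
  -- non-zero element, since otherwise 0, b and the family would be q + 1
  -- distinct elements
  covers : ∀ {N} (g : Fin N → Carrier) → InjF g → (∀ i → NZ (g i)) → suc N ≡ q →
           ∀ b → NZ b → ∃ λ i → b ≈ g i
  covers {N} g g-inj g≉0 N+1≡q b b≉0 with FinP.any? (λ i → b ≟ g i)
  ... | yes hit = hit
  ... | no miss = let (i , j , i<j , same-index) = FinP.pigeonhole q<N+2 (index ∘ value)
                  in ⊥-elim (clash i j (FinP.<⇒≢ i<j) (index-inj same-index))
    where
    value : Fin (suc (suc N)) → Carrier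
    value zero = 0#
    value (suc zero) = b
    value (suc (suc i)) = g i
    q<N+2 : q < suc (suc N)
    q<N+2 = ≡.subst (_< suc (suc N)) N+1≡q (ℕP.n<1+n (suc N))
    index-inj : ∀ {a b} → index a ≡ index b → a ≈ b
    index-inj {a} {b} eq = trans (sym (element-index a)) (trans (reflexive (≡.cong element eq)) (element-index b))
    clash : ∀ i j → i ≢ j → value i ≈ value j → ⊥
    clash zero zero i≢j _ = i≢j ≡.refl
    clash zero (suc zero) _ 0≈b = b≉0 (sym 0≈b)
    clash zero (suc (suc j)) _ 0≈g = g≉0 j (sym 0≈g)
    clash (suc zero) zero _ b≈0 = b≉0 b≈0
    clash (suc zero) (suc zero) i≢j _ = i≢j ≡.refl
    clash (suc zero) (suc (suc j)) _ b≈g = miss (j , b≈g)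
    clash (suc (suc i)) zero _ g≈0 = g≉0 i g≈0
    clash (suc (suc i)) (suc zero) _ g≈b = miss (i , sym g≈b)
    clash (suc (suc i)) (suc (suc j)) i≢j g≈g = i≢j (≡.cong (λ k → suc (suc k)) (g-inj i j g≈g))

  prodL-tabulate : ∀ {N} (g : Fin N → Carrier) → prodL (tabulate g) ≈ prodF g
  prodL-tabulate {zero} g = refl
  prodL-tabulate {suc N} g = *-congˡ (prodL-tabulate (g ∘ suc))

  tabulate-distinct : ∀ {N} (g : Fin N → Carrier) → InjF g → Distinct (tabulate g)
  tabulate-distinct {zero} g g-inj = _
  tabulate-distinct {suc N} g g-inj = g0∉ , tabulate-distinct (g ∘ suc) (λ i j e → FinP.suc-injective (g-inj (suc i) (suc j) e))
    where
    g0∉ : g zero ∉ₗ tabulate (g ∘ suc)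
    g0∉ g0∈ with g-inj zero (suc (proj₁ (∈-tabulate⁻ setoid g0∈))) (proj₂ (∈-tabulate⁻ setoid g0∈))
    ... | ()

  wilson : ∀ {N} (g : Fin N → Carrier) → InjF g → (∀ i → NZ (g i)) → suc N ≡ q →
           prodF g ≈ - 1#
  wilson g g-inj g≉0 N+1≡q = trans (sym (prodL-tabulate g))
    (wilson-list (tabulate g) (tabulate-distinct g g-inj) nonzero complete)
    where
    nonzero : ∀ b → b ∈ₗ tabulate g → NZ b
    nonzero b b∈ b≈0 = let (i , b≈gi) = ∈-tabulate⁻ setoid b∈ in g≉0 i (trans (sym b≈gi) b≈0)
    complete : ∀ b → NZ b → b ∈ₗ tabulate g
    complete b b≉0 = let (i , b≈gi) = covers g g-inj g≉0 N+1≡q b b≉0 in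
                     ∈-resp-≈ setoid (sym b≈gi) (∈-tabulate⁺ setoid i)

  -- (-1)^(q-1) = 1: compare Wilson's theorem for the non-zero elements
  -- and for their negatives
  negOnePow-q-1 : ∀ N → suc N ≡ q → negOnePow N ≈ 1#
  negOnePow-q-1 N ≡.refl = cancelˡ (neg-nz 1≉0) (begin
      - 1# * negOnePow N             ≈⟨ *-comm _ _ ⟩
      negOnePow N * - 1#             ≈⟨ *-congˡ (wilson g g-inj g≉0 ≡.refl) ⟨
      negOnePow N * prodF g          ≈⟨ prodF-neg g ⟨
      prodF (λ j → - g j)            ≈⟨ wilson (λ j → - g j) (λ i j e → g-inj i j (AdditiveGroup.⁻¹-injective e)) (neg-nz ∘ g≉0) ≡.refl ⟩
      - 1#                           ≈⟨ *-identityʳ _ ⟨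
      - 1# * 1#                      ∎)
    where
    g : Fin N → Carrier
    g j = element (punchIn (index 0#) j)
    g-inj : InjF g
    g-inj i j e = FinP.punchIn-injective (index 0#) i j (element-inj _ _ e)
    g≉0 : ∀ i → NZ (g i)
    g≉0 i gi≈0 = FinP.punchInᵢ≢i (index 0#) i (element-inj _ _ (trans gi≈0 (sym (element-index 0#))))

-- Coordinates: k + 1 vectors of F^k are linearly dependent (Gaussian
-- elimination on the first coordinate), hence k independent vectors of F^k
-- span F^k; linear forms are linear in these coordinates.
module Coordinates {c ℓ} (F : Field c ℓ) (_≟_ : Decidable (Field._≈_ F)) where
  open Field F hiding (zero)
  open FieldDefs F
  open FieldFacts F _≟_

  IsRelation : ∀ {m k} → (Fin m → Vect k) → (Fin m → Carrier) → Set ℓ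
  IsRelation vs cs = ∀ i → sumF (λ j → cs j * vs j i) ≈ 0#

  Dependent : ∀ {m k} → (Fin m → Vect k) → Set (c ⊔ ℓ)
  Dependent vs = Σ _ λ cs → IsRelation vs cs × ∃ λ j → NZ (cs j)

  dependent-zero-column : ∀ {k} (vs : Fin (suc (suc k)) → Vect (suc k)) →
    (∀ p → vs p zero ≈ 0#) → Dependent (λ j i → vs (suc j) (suc i)) → Dependent vs
  dependent-zero-column vs column≈0 (cs′ , relation′ , j , cs′j≉0) = cs , relation , suc j , cs′j≉0
    where
    cs : Fin _ → Carrier
    cs zero = 0#
    cs (suc j) = cs′ j
    relation : IsRelation vs cs
    relation zero = trans (+-cong (zeroˡ _) (sumF-0 (λ j → cs′ j * vs (suc j) zero) (λ j → trans (*-congˡ (column≈0 (suc j))) (zeroʳ _))))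
                          (+-identityˡ 0#)
    relation (suc i) = trans (+-cong (zeroˡ _) (relation′ i)) (+-identityˡ 0#)

  -- elimination with pivot vs p: subtract multiples r_j of vs p from the other
  -- vectors to clear their first coordinate
  module Pivot {k} (vs : Fin (suc (suc k)) → Vect (suc k)) (p : Fin (suc (suc k))) (pivot≉0 : NZ (vs p zero)) where
    r : Fin (suc k) → Carrier
    r j = vs (punchIn p j) zero * inv (vs p zero)

    eliminated : Fin (suc k) → Vect (suc k)
    eliminated j i = vs (punchIn p j) i + - (r j * vs p i)

    eliminated-0 : ∀ j → eliminated j zero ≈ 0#
    eliminated-0 j = trans (+-congˡ (-‿cong (div-mul pivot≉0))) (-‿inverseʳ _)

    -- a relation among the eliminated vectors, with coefficient
    -- -Σ_j cs′_j r_j at the pivot, is a relation among the vs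
    lift : Dependent (λ j i → eliminated j (suc i)) → Dependent vs
    lift (cs′ , relation′ , j₀ , cs′j₀≉0) = cs , relation , punchIn p j₀ , (λ ≈0 → cs′j₀≉0 (trans (sym (cs-punchIn j₀)) ≈0))
      where
      cs : Fin (suc (suc k)) → Carrier
      cs i with p FinP.≟ i
      ... | yes _ = - sumF (λ j → cs′ j * r j)
      ... | no p≢i = cs′ (punchOut p≢i)
      cs-pivot : cs p ≈ - sumF (λ j → cs′ j * r j)
      cs-pivot with p FinP.≟ p
      ... | yes _ = refl
      ... | no p≢p = ⊥-elim (p≢p ≡.refl)
      cs-punchIn : ∀ j → cs (punchIn p j) ≈ cs′ j
      cs-punchIn j with p FinP.≟ punchIn p j
      ... | yes p≡ = ⊥-elim (FinP.punchInᵢ≢i p j (≡.sym p≡))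
      ... | no _ = reflexive (≡.cong cs′ (≡.trans (FinP.punchOut-cong p ≡.refl) (FinP.punchOut-punchIn p)))
      relation-eliminated : IsRelation eliminated cs′
      relation-eliminated zero = sumF-0 (λ j → cs′ j * eliminated j zero) (λ j → trans (*-congˡ (eliminated-0 j)) (zeroʳ _))
      relation-eliminated (suc i) = relation′ i
      relation : IsRelation vs cs
      relation i = begin
        sumF (λ j → cs j * vs j i)
          ≈⟨ sumF-punch p (λ j → cs j * vs j i) ⟩
        cs p * y + sumF (λ j → cs (punchIn p j) * x j)
          ≈⟨ +-cong (*-congʳ cs-pivot) (sumF-cong (λ j → *-congʳ {x j} (cs-punchIn j))) ⟩
        - Σr * y + sumF (λ j → cs′ j * x j)
          ≈⟨ +-congʳ (trans (sym (-‿distribˡ-* Σr y)) (-‿cong (*-comm Σr y))) ⟩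
        - (y * Σr) + sumF (λ j → cs′ j * x j)
          ≈⟨ +-congʳ (-‿cong (sumF-* y (λ j → cs′ j * r j))) ⟨
        - sumF (λ j → y * (cs′ j * r j)) + sumF (λ j → cs′ j * x j)
          ≈⟨ +-congʳ (sumF-neg (λ j → y * (cs′ j * r j))) ⟨
        sumF (λ j → - (y * (cs′ j * r j))) + sumF (λ j → cs′ j * x j)
          ≈⟨ sumF-+ (λ j → - (y * (cs′ j * r j))) (λ j → cs′ j * x j) ⟨
        sumF (λ j → - (y * (cs′ j * r j)) + cs′ j * x j)
          ≈⟨ sumF-cong (λ j → distribute (cs′ j) (x j) (r j) y) ⟩
        sumF (λ j → cs′ j * eliminated j i)
          ≈⟨ relation-eliminated i ⟩
        0# ∎
        where
        distribute : ∀ a x r y → - (y * (a * r)) + a * x ≈ a * (x + - (r * y))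
        distribute a x r y = begin
          - (y * (a * r)) + a * x  ≈⟨ +-congʳ (-‿cong (Mul.x∙yz≈y∙zx y a r)) ⟩
          - (a * (r * y)) + a * x  ≈⟨ +-congʳ (-‿distribʳ-* a _) ⟩
          a * - (r * y) + a * x    ≈⟨ +-comm _ _ ⟩
          a * x + a * - (r * y)    ≈⟨ distribˡ a x _ ⟨
          a * (x + - (r * y))      ∎
        y : Carrier
        y = vs p i
        x : Fin (suc k) → Carrier
        x j = vs (punchIn p j) i
        Σr : Carrier
        Σr = sumF (λ j → cs′ j * r j)

  dependent : ∀ k (vs : Fin (suc k) → Vect k) → Dependent vs
  dependent zero vs = (λ _ → 1#) , (λ ()) , zero , 1≉0
  dependent (suc k) vs with FinP.any? (λ p → ¬? (vs p zero ≟ 0#))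
  ... | yes (p , pivot≉0) = Pivot.lift vs p pivot≉0 (dependent k (λ j i → Pivot.eliminated vs p pivot≉0 j (suc i)))
  ... | no no-pivot = dependent-zero-column vs column≈0 (dependent k (λ j i → vs (suc j) (suc i)))
    where
    column≈0 : ∀ p → vs p zero ≈ 0#
    column≈0 p with vs p zero ≟ 0#
    ... | yes ≈0 = ≈0
    ... | no ≉0 = ⊥-elim (no-pivot (p , ≉0))

  -- k linearly independent vectors of F^k span F^k: a dependence among
  -- v, B_0, …, B_{k-1} must involve v, so v is a combination of the B_l
  coordinates : ∀ {k} (B : Fin k → Vect k) → LinIndep B → ∀ v →
                Σ (Fin k → Carrier) λ co → ∀ i → v i ≈ sumF (λ l → co l * B l i)
  coordinates {k} B independent v with dependent k vs
    where
    vs : Fin (suc k) → Vect k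
    vs zero = v
    vs (suc l) = B l
  ... | cs , relation , j , csj≉0 with cs zero ≟ 0#
  ... | yes cs0≈0 = ⊥-elim (trivial j csj≉0)
    where
    relation-B : ∀ i → sumF (λ l → cs (suc l) * B l i) ≈ 0#
    relation-B i = trans (sym (+-identityˡ _)) (trans (+-congʳ (sym (trans (*-congʳ cs0≈0) (zeroˡ _)))) (relation i))
    trivial : ∀ j → ¬ NZ (cs j)
    trivial zero ≉0 = ≉0 cs0≈0
    trivial (suc l) ≉0 = ≉0 (independent (cs ∘ suc) relation-B l)
  ... | no cs0≉0 = (λ l → - (inv (cs zero) * cs (suc l))) , expansion
    where
    expansion : ∀ i → v i ≈ sumF (λ l → - (inv (cs zero) * cs (suc l)) * B l i)
    expansion i = sym (begin
      sumF (λ l → - (inv c₀ * cs (suc l)) * B l i)  ≈⟨ sumF-cong (λ l → trans (sym (-‿distribˡ-* (inv c₀ * cs (suc l)) (B l i))) (-‿cong (*-assoc (inv c₀) (cs (suc l)) (B l i)))) ⟩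
      sumF (λ l → - (inv c₀ * (cs (suc l) * B l i))) ≈⟨ sumF-neg (λ l → inv c₀ * (cs (suc l) * B l i)) ⟩
      - sumF (λ l → inv c₀ * (cs (suc l) * B l i))   ≈⟨ -‿cong (sumF-* (inv c₀) (λ l → cs (suc l) * B l i)) ⟩
      - (inv c₀ * sumF (λ l → cs (suc l) * B l i))   ≈⟨ -‿cong (*-congˡ (AdditiveGroup.inverseʳ-unique _ _ (relation i))) ⟩
      - (inv c₀ * - (c₀ * v i))                      ≈⟨ -‿cong (-‿distribʳ-* _ _) ⟨
      - - (inv c₀ * (c₀ * v i))                      ≈⟨ AdditiveGroup.⁻¹-involutive _ ⟩
      inv c₀ * (c₀ * v i)                            ≈⟨ *-assoc _ _ _ ⟨
      (inv c₀ * c₀) * v i                            ≈⟨ *-congʳ (inv-l cs0≉0) ⟩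
      1# * v i                                       ≈⟨ *-identityˡ _ ⟩
      v i                                            ∎)
      where c₀ = cs zero

  dot-linear : ∀ {k m} (u v : Vect k) (co : Fin m → Carrier) (B : Fin m → Vect k) →
               (∀ i → v i ≈ sumF (λ l → co l * B l i)) →
               dot u v ≈ sumF (λ l → co l * dot u (B l))
  dot-linear {k} {m} u v co B expansion = begin
    sumF (λ i → u i * v i)                            ≈⟨ sumF-cong (λ i → *-congˡ (expansion i)) ⟩
    sumF (λ i → u i * sumF (λ l → co l * B l i))       ≈⟨ sumF-cong (λ i → sumF-* (u i) (λ l → co l * B l i)) ⟨
    sumF (λ i → sumF (λ l → u i * (co l * B l i)))     ≈⟨ sumF-swap {k} {m} (λ i l → u i * (co l * B l i)) ⟩
    sumF (λ l → sumF (λ i → u i * (co l * B l i)))     ≈⟨ sumF-cong (λ l → sumF-cong (λ i → Mul.x∙yz≈y∙xz (u i) (co l) (B l i))) ⟩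
    sumF (λ l → sumF (λ i → co l * (u i * B l i)))     ≈⟨ sumF-cong (λ l → sumF-* (co l) (λ i → u i * B l i)) ⟩
    sumF (λ l → co l * dot u (B l))                   ∎

Elements : ∀ {n} → Subset n → ℕ → Set
Elements {n} S m = Σ (Fin m → Fin n) λ f → Injective _≡_ _≡_ f × (∀ i → f i ∈ S)

elements : ∀ {n} (S : Subset n) → Elements S ∣ S ∣
elements {zero} [] = (λ ()) , (λ {}) , (λ ())
elements {suc n} (inside ∷ S) with elements S
... | f , f-inj , f∈S = g , g-inj , g∈
  where
  g : Fin (suc ∣ S ∣) → Fin (suc n)
  g zero = zero
  g (suc i) = suc (f i)
  g-inj : Injective _≡_ _≡_ g
  g-inj {zero} {zero} _ = ≡.refl
  g-inj {suc i} {suc j} eq = ≡.cong suc (f-inj (FinP.suc-injective eq))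
  g∈ : ∀ i → g i ∈ (inside ∷ S)
  g∈ zero = here
  g∈ (suc i) = there (f∈S i)
elements {suc n} (outside ∷ S) with elements S
... | f , f-inj , f∈S = suc ∘ f , f-inj ∘ FinP.suc-injective , there ∘ f∈S

elements-of-size : ∀ {n} (S : Subset n) {m} → ∣ S ∣ ≡ m → Elements S m
elements-of-size S ≡.refl = elements S

∣∪⁅x⁆∣ : ∀ {n} (S : Subset n) (x : Fin n) → x ∉ S → ∣ S ∪ ⁅ x ⁆ ∣ ≡ suc ∣ S ∣
∣∪⁅x⁆∣ (inside ∷ S) zero x∉ = ⊥-elim (x∉ here)
∣∪⁅x⁆∣ (outside ∷ S) zero x∉ = ≡.cong (λ T → suc ∣ T ∣) (∪-identityʳ S)
∣∪⁅x⁆∣ (inside ∷ S) (suc x) x∉ = ≡.cong suc (∣∪⁅x⁆∣ S x (x∉ ∘ there))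
∣∪⁅x⁆∣ (outside ∷ S) (suc x) x∉ = ∣∪⁅x⁆∣ S x (x∉ ∘ there)

∈∪⁅x⁆ : ∀ {n} {S : Subset n} {x w} → w ∈ S ∪ ⁅ x ⁆ → w ∈ S ⊎ w ≡ x
∈∪⁅x⁆ {S = S} {x} w∈ with x∈p∪q⁻ S ⁅ x ⁆ w∈
... | inj₁ w∈S = inj₁ w∈S
... | inj₂ w∈⁅x⁆ = inj₂ (x∈⁅y⁆⇒x≡y x w∈⁅x⁆)

∉∪⁅x⁆ : ∀ {n} {S : Subset n} {x w} → w ∉ S → w ≢ x → w ∉ S ∪ ⁅ x ⁆
∉∪⁅x⁆ w∉S w≢x w∈ = [ w∉S , w≢x ]′ (∈∪⁅x⁆ w∈)

≡⇒∈∪⁅x⁆ : ∀ {n} (S : Subset n) {w x : Fin n} → w ≡ x → w ∈ S ∪ ⁅ x ⁆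
≡⇒∈∪⁅x⁆ S {w} ≡.refl = x∈p∪q⁺ (inj₂ (x∈⁅x⁆ w))

S⊆S∪⁅x⁆ : ∀ {n} {S : Subset n} {x w} → w ∈ S → w ∈ S ∪ ⁅ x ⁆
S⊆S∪⁅x⁆ w∈S = x∈p∪q⁺ (inj₁ w∈S)

∷-injective : ∀ {m n} {x : Fin n} {f : Fin m → Fin n} →
              (∀ i → x ≢ f i) → Injective _≡_ _≡_ f → Injective _≡_ _≡_ (x ∷ᶠ f)
∷-injective x-new f-inj {zero} {zero} _ = ≡.refl
∷-injective x-new f-inj {zero} {suc j} eq = ⊥-elim (x-new j eq)
∷-injective x-new f-inj {suc i} {zero} eq = ⊥-elim (x-new i (≡.sym eq))
∷-injective x-new f-inj {suc i} {suc j} eq = ≡.cong suc (f-inj eq)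

decidable-≈ : ∀ {c ℓ} (F : Field c ℓ) q → FieldDefs.HasCard F q → Decidable (Field._≈_ F)
decidable-≈ F q (element , element-inj , onto) x y with proj₁ (onto x) FinP.≟ proj₁ (onto y)
... | yes eq = yes (trans (sym (proj₂ (onto x))) (trans (reflexive (≡.cong element eq)) (proj₂ (onto y))))
  where open Field F
... | no ne = no (λ x≈y → ne (element-inj _ _ (trans (proj₂ (onto x)) (trans x≈y (sym (proj₂ (onto y)))))))
  where open Field F

-- with n + t + 1 = q + k, the n - k arc points off a basis and the t
-- tangents number q - 1 together
count-q-1 : ∀ k n t q → k ≤ n → n +ℕ t +ℕ 1 ≡ q +ℕ k → suc (t +ℕ (n ∸ k)) ≡ q
count-q-1 k n t q k≤n eqn = ℕP.+-cancelʳ-≡ k (suc (t +ℕ (n ∸ k))) q (begin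
    suc (t +ℕ (n ∸ k)) +ℕ k       ≡⟨ rearrange t (n ∸ k) k ⟩
    (k +ℕ (n ∸ k)) +ℕ t +ℕ 1      ≡⟨ ≡.cong (λ x → x +ℕ t +ℕ 1) (ℕP.m+[n∸m]≡n k≤n) ⟩
    n +ℕ t +ℕ 1                   ≡⟨ eqn ⟩
    q +ℕ k                        ∎)
  where
  open ≡.≡-Reasoning
  rearrange : ∀ t d k → suc (t +ℕ d) +ℕ k ≡ (k +ℕ d) +ℕ t +ℕ 1
  rearrange = solve-∀

size-outside-D : ∀ q k₃ n → n +ℕ 0 +ℕ 1 ≡ q +ℕ suc (suc (suc k₃)) → n ∸ k₃ ≡ suc (suc q)
size-outside-D q k₃ n eqn = begin
    n ∸ k₃                          ≡⟨ ≡.cong (_∸ k₃) n≡ ⟩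
    suc (suc q) +ℕ k₃ ∸ k₃          ≡⟨ ℕP.m+n∸n≡m (suc (suc q)) k₃ ⟩
    suc (suc q)                     ∎
  where
  open ≡.≡-Reasoning
  shift : ∀ q k₃ → q +ℕ suc (suc (suc k₃)) ≡ suc (suc q) +ℕ k₃ +ℕ 1
  shift = solve-∀
  n≡ : n ≡ suc (suc q) +ℕ k₃
  n≡ = ℕP.+-cancelʳ-≡ 1 n (suc (suc q) +ℕ k₃)
         (≡.trans (≡.cong (_+ℕ 1) (≡.sym (ℕP.+-identityʳ n))) (≡.trans eqn (shift q k₃)))

-- The setting of the theorem with k = k₃ + 3: an arc a of n points in F^k
-- over the field F with q elements, the t tangent forms L S of every
-- (k-2)-set S, and a (k-3)-set D.
module Configuration {c ℓ} (F : Field c ℓ) (q : ℕ) (card : FieldDefs.HasCard F q) (k₃ t n : ℕ)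
  (a : Fin n → FieldDefs.Vect F (suc (suc (suc k₃))))
  (arc : FieldDefs.IsArc F a)
  (L : Subset n → Fin t → FieldDefs.Vect F (suc (suc (suc k₃))))
  (tangents : ∀ S → ∣ S ∣ ≡ suc k₃ → FieldDefs.TangentForms F a S (L S))
  (D : Subset n) (∣D∣ : ∣ D ∣ ≡ k₃)
  where
  open Field F hiding (zero)
  open FieldDefs F

  _≟_ : Decidable _≈_
  _≟_ = decidable-≈ F q card

  open FieldFacts F _≟_
  open Wilson F _≟_ q card using (wilson)
  open Coordinates F _≟_ using (dot-linear)

  dE : Fin k₃ → Fin n
  dE = proj₁ (elements-of-size D ∣D∣)

  dE-inj : Injective _≡_ _≡_ dE
  dE-inj = proj₁ (proj₂ (elements-of-size D ∣D∣))

  dE∈D : ∀ i → dE i ∈ D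
  dE∈D = proj₂ (proj₂ (elements-of-size D ∣D∣))

  k : ℕ
  k = suc (suc (suc k₃))

  record Triple (p r s : Fin n) : Set where
    constructor triple
    field
      p≢r : p ≢ r
      p≢s : p ≢ s
      r≢s : r ≢ s
      p∉D : p ∉ D
      r∉D : r ∉ D
      s∉D : s ∉ D

  record NewPoint (w p r s : Fin n) : Set where
    constructor new-point
    field
      w∉D : w ∉ D
      w≢p : w ≢ p
      w≢r : w ≢ r
      w≢s : w ≢ s

  frame : Fin n → Fin n → Fin n → Fin k → Fin n
  frame p r s = p ∷ᶠ r ∷ᶠ s ∷ᶠ dE

  ∉D⇒≢dE : ∀ {w} → w ∉ D → ∀ i → w ≢ dE i
  ∉D⇒≢dE w∉D i w≡dEi = w∉D (≡.subst (_∈ D) (≡.sym w≡dEi) (dE∈D i))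

  frame-injective : ∀ {p r s} → Triple p r s → Injective _≡_ _≡_ (frame p r s)
  frame-injective {p} {r} {s} (triple p≢r p≢s r≢s p∉D r∉D s∉D) =
    ∷-injective p-new (∷-injective r-new (∷-injective (∉D⇒≢dE s∉D) dE-inj))
    where
    p-new : ∀ i → p ≢ (r ∷ᶠ s ∷ᶠ dE) i
    p-new zero = p≢r
    p-new (suc zero) = p≢s
    p-new (suc (suc i)) = ∉D⇒≢dE p∉D i
    r-new : ∀ i → r ≢ (s ∷ᶠ dE) i
    r-new zero = r≢s
    r-new (suc i) = ∉D⇒≢dE r∉D i

  combination : (Fin k → Fin n) → (Fin k → Carrier) → Vect k
  combination σ cs i = sumF (λ l → cs l * a (σ l) i)

  on-D : (Fin k₃ → Carrier) → Vect k
  on-D δ i = sumF (λ l → δ l * a (dE l) i)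

  drop-coefficient : ∀ {c} x y → c ≈ 0# → c * x + y ≈ y
  drop-coefficient x y c≈0 = trans (+-congʳ (trans (*-congʳ c≈0) (zeroˡ x))) (+-identityˡ y)

  drop-vanishing : ∀ c {x} y → x ≈ 0# → c * x + y ≈ y
  drop-vanishing c y x≈0 = trans (+-congʳ (trans (*-congˡ x≈0) (zeroʳ c))) (+-identityˡ y)

  -- the arc property: a point w is never a combination of two further
  -- points and the points of D (these k points are independent)
  not-in-span : ∀ {w p r} → Triple w p r → ∀ α β δ →
                ¬ (∀ i → a w i ≈ α * a p i + (β * a r i + on-D δ i))
  not-in-span {w} {p} {r} wpr α β δ expansion =
    neg-nz 1≉0 (arc (frame w p r) (frame-injective wpr) (- 1# ∷ᶠ α ∷ᶠ β ∷ᶠ δ) relation zero)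
    where
    relation : ∀ i → - 1# * a w i + (α * a p i + (β * a r i + on-D δ i)) ≈ 0#
    relation i = trans (+-congʳ (trans (-1*x≈-x _) (-‿cong (expansion i)))) (-‿inverseˡ _)

  combination-difference : ∀ σ (cs ds : Fin k → Carrier) κ i →
    combination σ (λ l → cs l + - (κ * ds l)) i ≈ combination σ cs i + - (κ * combination σ ds i)
  combination-difference σ cs ds κ i = begin
    sumF (λ l → (cs l + - (κ * ds l)) * x l)          ≈⟨ sumF-cong (λ l → distribute (cs l) (ds l) (x l)) ⟩
    sumF (λ l → cs l * x l + - (κ * (ds l * x l)))    ≈⟨ sumF-+ (λ l → cs l * x l) (λ l → - (κ * (ds l * x l))) ⟩
    combination σ cs i + sumF (λ l → - (κ * (ds l * x l)))  ≈⟨ +-congˡ (sumF-neg (λ l → κ * (ds l * x l))) ⟩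
    combination σ cs i + - sumF (λ l → κ * (ds l * x l))    ≈⟨ +-congˡ (-‿cong (sumF-* κ (λ l → ds l * x l))) ⟩
    combination σ cs i + - (κ * combination σ ds i)         ∎
    where
    x : Fin k → Carrier
    x l = a (σ l) i
    distribute : ∀ c d y → (c + - (κ * d)) * y ≈ c * y + - (κ * (d * y))
    distribute c d y = trans (distribʳ y c _)
      (+-congˡ (trans (sym (-‿distribˡ-* (κ * d) y)) (-‿cong (*-assoc κ d y))))

  proportional⇒same-hyperplane : ∀ (u w : Vect k) (μ : Carrier) → NZ μ →
                                  (∀ v → dot w v ≈ μ * dot u v) → SameHyperplane u w
  proportional⇒same-hyperplane u w μ μ≉0 w≈μu v =
    (λ uv≈0 → trans (w≈μu v) (trans (*-congˡ uv≈0) (zeroʳ μ))) ,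
    (λ wv≈0 → [ (λ μ≈0 → ⊥-elim (μ≉0 μ≈0)) , (λ uv≈0 → uv≈0) ]′ (zero-product (trans (sym (w≈μu v)) wv≈0)))

  -- One role (p, r, s) of three distinct points outside D, for S = D ∪ {p}.
  -- co v are the coordinates of v in the basis frame p r s; the m points
  -- `others` are the arc points outside D ∪ {p, r, s}.
  module Role (p r s : Fin n) (prs : Triple p r s)
              (co : Vect k → Fin k → Carrier)
              (expand : ∀ v i → v i ≈ combination (frame p r s) (co v) i)
              (m : ℕ) (others : Fin m → Fin n) (others-inj : Injective _≡_ _≡_ others)
              (others-new : ∀ j → NewPoint (others j) p r s)
              (count : suc (t +ℕ m) ≡ q)
              where
    open Triple prs using (p≢r; p≢s; p∉D; r∉D; s∉D)

    S : Subset n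
    S = D ∪ ⁅ p ⁆

    tangent : TangentForms a S (L S)
    tangent = tangents S (≡.trans (∣∪⁅x⁆∣ D p p∉D) (≡.cong suc ∣D∣))

    u : Fin t → Vect k
    u = L S

    u-vanishes-on-S : ∀ {w} → w ∈ S → ∀ j → dot (u j) (a w) ≈ 0#
    u-vanishes-on-S w∈S j = proj₂ (proj₁ (proj₂ tangent) j _) w∈S

    u-nonzero-off-S : ∀ {w} → w ∉ D → w ≢ p → ∀ j → NZ (dot (u j) (a w))
    u-nonzero-off-S w∉D w≢p j uw≈0 = ∉∪⁅x⁆ w∉D w≢p (proj₁ (proj₁ (proj₂ tangent) j _) uw≈0)

    ur us : Fin t → Carrier
    ur j = dot (u j) (a r)
    us j = dot (u j) (a s)

    ur≉0 : ∀ j → NZ (ur j)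
    ur≉0 = u-nonzero-off-S r∉D (p≢r ∘ ≡.sym)
    us≉0 : ∀ j → NZ (us j)
    us≉0 = u-nonzero-off-S s∉D (p≢s ∘ ≡.sym)

    cr cs : Vect k → Carrier
    cr v = co v (suc zero)
    cs v = co v (suc (suc zero))

    -- a tangent form vanishes on p and on D, so only the r and s
    -- coordinates contribute
    tangent-in-coordinates : ∀ j v → dot (u j) v ≈ cr v * ur j + cs v * us j
    tangent-in-coordinates j v = begin
      dot (u j) v
        ≈⟨ dot-linear (u j) v (co v) (λ l → a (frame p r s l)) (expand v) ⟩
      co v zero * dot (u j) (a p) + (cr v * ur j + (cs v * us j + sumF (λ l → co v (suc (suc (suc l))) * dot (u j) (a (dE l)))))
        ≈⟨ drop-vanishing _ _ (u-vanishes-on-S (≡⇒∈∪⁅x⁆ D ≡.refl) j) ⟩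
      cr v * ur j + (cs v * us j + sumF (λ l → co v (suc (suc (suc l))) * dot (u j) (a (dE l))))
        ≈⟨ +-congˡ (+-congˡ (sumF-0 _ (λ l → trans (*-congˡ (u-vanishes-on-S (S⊆S∪⁅x⁆ (dE∈D l)) j)) (zeroʳ _)))) ⟩
      cr v * ur j + (cs v * us j + 0#)
        ≈⟨ +-congˡ (+-identityʳ _) ⟩
      cr v * ur j + cs v * us j ∎

    λ′ : Fin t → Carrier
    λ′ j = us j * inv (ur j)

    λ′≉0 : ∀ j → NZ (λ′ j)
    λ′≉0 j = nz-* (us≉0 j) (inv-nz (ur≉0 j))

    us≈λ′ur : ∀ j → us j ≈ λ′ j * ur j
    us≈λ′ur j = sym (div-mul (ur≉0 j))

    Λ : Carrier
    Λ = prodF λ′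

    fS-ratio : fS u (a s) ≈ Λ * fS u (a r)
    fS-ratio = trans (prodF-cong us≈λ′ur) (prodF-* λ′ ur)

    -- equal ratios would make two tangent forms proportional
    λ′-injective : InjF λ′
    λ′-injective j j′ λ′j≈λ′j′ =
      proj₁ (proj₂ (proj₂ tangent)) j j′ (proportional⇒same-hyperplane (u j) (u j′) μ μ≉0 proportional)
      where
      μ : Carrier
      μ = ur j′ * inv (ur j)
      μ≉0 : NZ μ
      μ≉0 = nz-* (ur≉0 j′) (inv-nz (ur≉0 j))
      ur′≈μur : ur j′ ≈ μ * ur j
      ur′≈μur = sym (div-mul (ur≉0 j))
      us′≈μus : us j′ ≈ μ * us j
      us′≈μus = begin
        us j′               ≈⟨ us≈λ′ur j′ ⟩
        λ′ j′ * ur j′       ≈⟨ *-cong (sym λ′j≈λ′j′) ur′≈μur ⟩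
        λ′ j * (μ * ur j)   ≈⟨ Mul.x∙yz≈y∙xz _ _ _ ⟩
        μ * (λ′ j * ur j)   ≈⟨ *-congˡ (sym (us≈λ′ur j)) ⟩
        μ * us j            ∎
      proportional : ∀ v → dot (u j′) v ≈ μ * dot (u j) v
      proportional v = begin
        dot (u j′) v                            ≈⟨ tangent-in-coordinates j′ v ⟩
        cr v * ur j′ + cs v * us j′             ≈⟨ +-cong (*-congˡ ur′≈μur) (*-congˡ us′≈μus) ⟩
        cr v * (μ * ur j) + cs v * (μ * us j)   ≈⟨ +-cong (Mul.x∙yz≈y∙xz _ _ _) (Mul.x∙yz≈y∙xz _ _ _) ⟩
        μ * (cr v * ur j) + μ * (cs v * us j)   ≈⟨ distribˡ μ _ _ ⟨
        μ * (cr v * ur j + cs v * us j)         ≈⟨ *-congˡ (tangent-in-coordinates j v) ⟨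
        μ * dot (u j) v                         ∎

    cw : Fin m → Fin k → Carrier
    cw j = co (a (others j))

    -- an other point w has non-zero r- and s-coordinates: otherwise w would
    -- lie in the span of p, s, D (resp. p, r, D)
    cr≉0 : ∀ j → NZ (cr (a (others j)))
    cr≉0 j cr≈0 = not-in-span (triple w≢p w≢s p≢s w∉D p∉D s∉D) _ _ _
      (λ i → trans (expand _ i) (+-congˡ (drop-coefficient _ _ cr≈0)))
      where open NewPoint (others-new j)

    cs≉0 : ∀ j → NZ (cs (a (others j)))
    cs≉0 j cs≈0 = not-in-span (triple w≢p w≢r p≢r w∉D p∉D r∉D) _ _ _
      (λ i → trans (expand _ i) (+-congˡ (+-congˡ (drop-coefficient _ _ cs≈0))))
      where open NewPoint (others-new j)

    ρ : Fin m → Carrier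
    ρ j = - (cr (a (others j)) * inv (cs (a (others j))))

    ρ≉0 : ∀ j → NZ (ρ j)
    ρ≉0 j = neg-nz (nz-* (cr≉0 j) (inv-nz (cs≉0 j)))

    -- equal ratios for w ≠ w′ would put w in the span of p, w′ and D:
    -- w - κ w′ has vanishing r- and s-coordinates for κ = c_s(w) / c_s(w′)
    ρ-injective : InjF ρ
    ρ-injective j j′ ρj≈ρj′ with j FinP.≟ j′
    ... | yes j≡j′ = j≡j′
    ... | no j≢j′ = ⊥-elim (not-in-span (triple w≢p w≢w′ (w′≢p ∘ ≡.sym) w∉D p∉D w′∉D) _ κ _ w-expansion)
      where
      open NewPoint (others-new j) using (w∉D; w≢p)
      open NewPoint (others-new j′) using () renaming (w∉D to w′∉D; w≢p to w′≢p)
      w w′ : Fin n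
      w = others j
      w′ = others j′
      w≢w′ : w ≢ w′
      w≢w′ = j≢j′ ∘ others-inj
      κ : Carrier
      κ = cs (a w) * inv (cs (a w′))
      e : Fin k → Carrier
      e l = cw j l + - (κ * cw j′ l)
      er≈0 : e (suc zero) ≈ 0#
      er≈0 = trans (+-congʳ cr≈κcr′) (-‿inverseʳ _)
        where
        cr≈κcr′ : cr (a w) ≈ κ * cr (a w′)
        cr≈κcr′ = begin
          cr (a w)                                            ≈⟨ div-mul (cs≉0 j) ⟨
          (cr (a w) * inv (cs (a w))) * cs (a w)              ≈⟨ *-congʳ (AdditiveGroup.⁻¹-injective ρj≈ρj′) ⟩
          (cr (a w′) * inv (cs (a w′))) * cs (a w)            ≈⟨ Mul.xy∙z≈zy∙x _ _ _ ⟩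
          κ * cr (a w′)                                       ∎
      es≈0 : e (suc (suc zero)) ≈ 0#
      es≈0 = trans (+-congʳ (sym (div-mul (cs≉0 j′)))) (-‿inverseʳ _)
      difference : ∀ i → combination (frame p r s) e i ≈ a w i + - (κ * a w′ i)
      difference i = trans (combination-difference (frame p r s) (cw j) (cw j′) κ i)
        (sym (+-cong (expand (a w) i) (-‿cong (*-congˡ (expand (a w′) i)))))
      w-expansion : ∀ i → a w i ≈ e zero * a p i + (κ * a w′ i + on-D (λ l → e (suc (suc (suc l)))) i)
      w-expansion i = sym (begin
        e zero * a p i + (κ * a w′ i + on-D _ i)
          ≈⟨ Add.x∙yz≈y∙xz _ _ _ ⟩
        κ * a w′ i + (e zero * a p i + on-D _ i)
          ≈⟨ +-congˡ (+-congˡ (drop-coefficient _ _ er≈0)) ⟨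
        κ * a w′ i + (e zero * a p i + (e (suc zero) * a r i + on-D _ i))
          ≈⟨ +-congˡ (+-congˡ (+-congˡ (drop-coefficient _ _ es≈0))) ⟨
        κ * a w′ i + combination (frame p r s) e i
          ≈⟨ +-congˡ (difference i) ⟩
        κ * a w′ i + (a w i + - (κ * a w′ i))
          ≈⟨ Add.x∙yz≈y∙xz _ _ _ ⟩
        a w i + (κ * a w′ i + - (κ * a w′ i))
          ≈⟨ +-congˡ (-‿inverseʳ _) ⟩
        a w i + 0#
          ≈⟨ +-identityʳ _ ⟩
        a w i ∎)

    -- if λ_j = ρ_w then u_j(w) = c_r(w) u_j(r) + c_s(w) λ_j u_j(r) = 0,
    -- i.e. the tangent hyperplane u_j would contain w
    λ′≢ρ : ∀ i j → ¬ (λ′ i ≈ ρ j)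
    λ′≢ρ i j λ′i≈ρj = u-nonzero-off-S w∉D w≢p i (begin
      dot (u i) (a w)                               ≈⟨ tangent-in-coordinates i (a w) ⟩
      C₁ * ur i + C₂ * us i                         ≈⟨ +-congˡ (*-congˡ (trans (us≈λ′ur i) (*-congʳ λ′i≈ρj))) ⟩
      C₁ * ur i + C₂ * (- (C₁ * inv C₂) * ur i)     ≈⟨ +-congˡ (*-congˡ (-‿distribˡ-* _ _)) ⟨
      C₁ * ur i + C₂ * - ((C₁ * inv C₂) * ur i)     ≈⟨ +-congˡ (-‿distribʳ-* _ _) ⟨
      C₁ * ur i + - (C₂ * ((C₁ * inv C₂) * ur i))   ≈⟨ +-congˡ (-‿cong cancel) ⟩
      C₁ * ur i + - (C₁ * ur i)                     ≈⟨ -‿inverseʳ _ ⟩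
      0#                                            ∎)
      where
      open NewPoint (others-new j) using (w∉D; w≢p)
      w : Fin n
      w = others j
      C₁ C₂ : Carrier
      C₁ = cr (a w)
      C₂ = cs (a w)
      cancel : C₂ * ((C₁ * inv C₂) * ur i) ≈ C₁ * ur i
      cancel = trans (Mul.x∙yz≈xy∙z _ _ _) (*-congʳ (trans (*-comm _ _) (div-mul (cs≉0 j))))

    R : Carrier
    R = prodF ρ

    -- the λ_j and ρ_w are t + m = q - 1 distinct non-zero scalars
    ΛR≈-1 : Λ * R ≈ - 1#
    ΛR≈-1 = trans (sym (prodF-append λ′ ρ))
      (wilson (append λ′ ρ) (append-inj λ′ ρ λ′-injective ρ-injective λ′≢ρ) (append-nz λ′ ρ λ′≉0 ρ≉0) count)

  module ThreeRoles (eqn : n +ℕ t +ℕ 1 ≡ q +ℕ k) (x y z : Fin n) (xyz : Triple x y z) where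
    open Coordinates F _≟_ using (coordinates)
    module ×-Solver = CommutativeMonoidSolver *-commutativeMonoid

    open Triple xyz renaming (p≢r to x≢y; p≢s to x≢z; r≢s to y≢z; p∉D to x∉D; r∉D to y∉D; s∉D to z∉D)

    -- coordinates in the basis x, y, z, D, and their two cyclic rotations
    coX : Vect k → Fin k → Carrier
    coX v = proj₁ (coordinates (a ∘ frame x y z) (arc (frame x y z) (frame-injective xyz)) v)

    expandX : ∀ v i → v i ≈ combination (frame x y z) (coX v) i
    expandX v = proj₂ (coordinates (a ∘ frame x y z) (arc (frame x y z) (frame-injective xyz)) v)

    coY coZ : Vect k → Fin k → Carrier
    coY v = coX v (suc zero) ∷ᶠ coX v (suc (suc zero)) ∷ᶠ coX v zero ∷ᶠ (λ l → coX v (suc (suc (suc l))))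
    coZ v = coX v (suc (suc zero)) ∷ᶠ coX v zero ∷ᶠ coX v (suc zero) ∷ᶠ (λ l → coX v (suc (suc (suc l))))

    rotate : ∀ a b c d → a + (b + (c + d)) ≈ b + (c + (a + d))
    rotate a b c d = trans (Add.x∙yz≈y∙xz a b _) (+-congˡ (Add.x∙yz≈y∙xz a c d))

    expandY : ∀ v i → v i ≈ combination (frame y z x) (coY v) i
    expandY v i = trans (expandX v i) (rotate _ _ _ _)

    expandZ : ∀ v i → v i ≈ combination (frame z x y) (coZ v) i
    expandZ v i = trans (expandX v i) (sym (rotate _ _ _ _))

    U : Subset n
    U = ((D ∪ ⁅ x ⁆) ∪ ⁅ y ⁆) ∪ ⁅ z ⁆

    ∣U∣ : ∣ U ∣ ≡ k
    ∣U∣ = ≡.trans (∣∪⁅x⁆∣ _ z (∉∪⁅x⁆ (∉∪⁅x⁆ z∉D (x≢z ∘ ≡.sym)) (y≢z ∘ ≡.sym)))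
          (≡.cong suc (≡.trans (∣∪⁅x⁆∣ _ y (∉∪⁅x⁆ y∉D (x≢y ∘ ≡.sym)))
          (≡.cong suc (≡.trans (∣∪⁅x⁆∣ D x x∉D) (≡.cong suc ∣D∣)))))

    m : ℕ
    m = n ∸ k

    others-listing : Elements (∁ U) m
    others-listing = elements-of-size (∁ U) (≡.trans (∣∁p∣≡n∸∣p∣ U) (≡.cong (n ∸_) ∣U∣))

    others : Fin m → Fin n
    others = proj₁ others-listing

    others-inj : Injective _≡_ _≡_ others
    others-inj = proj₁ (proj₂ others-listing)

    others∉U : ∀ j → others j ∉ U
    others∉U j = x∈∁p⇒x∉p (proj₂ (proj₂ others-listing) j)

    others∉D : ∀ j → others j ∉ D
    others∉D j = others∉U j ∘ S⊆S∪⁅x⁆ ∘ S⊆S∪⁅x⁆ ∘ S⊆S∪⁅x⁆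

    others≢x : ∀ j → others j ≢ x
    others≢x j w≡x = others∉U j (S⊆S∪⁅x⁆ (S⊆S∪⁅x⁆ (≡⇒∈∪⁅x⁆ D w≡x)))

    others≢y : ∀ j → others j ≢ y
    others≢y j w≡y = others∉U j (S⊆S∪⁅x⁆ (≡⇒∈∪⁅x⁆ (D ∪ ⁅ x ⁆) w≡y))

    others≢z : ∀ j → others j ≢ z
    others≢z j w≡z = others∉U j (≡⇒∈∪⁅x⁆ ((D ∪ ⁅ x ⁆) ∪ ⁅ y ⁆) w≡z)

    count : suc (t +ℕ m) ≡ q
    count = count-q-1 k n t q (FinP.injective⇒≤ (frame-injective xyz)) eqn

    module RX = Role x y z xyz coX expandX m others others-inj
                     (λ j → new-point (others∉D j) (others≢x j) (others≢y j) (others≢z j)) count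
    module RY = Role y z x (triple y≢z (x≢y ∘ ≡.sym) (x≢z ∘ ≡.sym) y∉D z∉D x∉D) coY expandY m others others-inj
                     (λ j → new-point (others∉D j) (others≢y j) (others≢z j) (others≢x j)) count
    module RZ = Role z x y (triple (x≢z ∘ ≡.sym) (y≢z ∘ ≡.sym) x≢y z∉D x∉D y∉D) coZ expandZ m others others-inj
                     (λ j → new-point (others∉D j) (others≢z j) (others≢x j) (others≢y j)) count

    -- for each other point the three secant ratios multiply to -1
    R-product : RX.R * (RY.R * RZ.R) ≈ negOnePow m
    R-product = begin
      RX.R * (RY.R * RZ.R)                         ≈⟨ *-congˡ (prodF-* RY.ρ RZ.ρ) ⟨
      RX.R * prodF (λ j → RY.ρ j * RZ.ρ j)         ≈⟨ prodF-* RX.ρ (λ j → RY.ρ j * RZ.ρ j) ⟨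
      prodF (λ j → RX.ρ j * (RY.ρ j * RZ.ρ j))     ≈⟨ prodF-cong (λ j → ratio-cycle (RY.cs≉0 j) (RX.cr≉0 j) (RX.cs≉0 j)) ⟩
      prodF {m} (λ _ → - 1#)                       ≈⟨ prodF-const-1 m ⟩
      negOnePow m                                  ∎

    -- combining the three roles, with (-1)^(t+m) = (-1)^(q-1) = 1
    Λ-product : RX.Λ * (RY.Λ * RZ.Λ) ≈ negOnePow (suc t)
    Λ-product = begin
      Λ₃                                              ≈⟨ *-identityʳ Λ₃ ⟨
      Λ₃ * 1#                                         ≈⟨ *-congˡ (negOnePow-square m) ⟨
      Λ₃ * (negOnePow m * negOnePow m)                ≈⟨ *-assoc _ _ _ ⟨
      (Λ₃ * negOnePow m) * negOnePow m                ≈⟨ *-congʳ Λ₃R₃ ⟩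
      - 1# * negOnePow m                              ≈⟨ *-congˡ (*-identityʳ _) ⟨
      - 1# * (negOnePow m * 1#)                       ≈⟨ *-congˡ (*-congˡ (negOnePow-q-1 (t +ℕ m) count)) ⟨
      - 1# * (negOnePow m * negOnePow (t +ℕ m))       ≈⟨ *-congˡ (*-congˡ (negOnePow-+ t m)) ⟩
      - 1# * (negOnePow m * (negOnePow t * negOnePow m))  ≈⟨ *-congˡ (Mul.x∙yz≈y∙xz _ _ _) ⟩
      - 1# * (negOnePow t * (negOnePow m * negOnePow m))  ≈⟨ *-congˡ (*-congˡ (negOnePow-square m)) ⟩
      - 1# * (negOnePow t * 1#)                       ≈⟨ *-congˡ (*-identityʳ _) ⟩
      negOnePow (suc t)                               ∎
      where
      open Wilson F _≟_ q card using (negOnePow-q-1)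
      Λ₃ : Carrier
      Λ₃ = RX.Λ * (RY.Λ * RZ.Λ)
      Λ₃R₃ : Λ₃ * negOnePow m ≈ - 1#
      Λ₃R₃ = begin
        Λ₃ * negOnePow m                                   ≈⟨ *-congˡ R-product ⟨
        Λ₃ * (RX.R * (RY.R * RZ.R))                        ≈⟨ Mul.interchange _ _ _ _ ⟩
        (RX.Λ * RX.R) * ((RY.Λ * RZ.Λ) * (RY.R * RZ.R))    ≈⟨ *-congˡ (Mul.interchange _ _ _ _) ⟩
        (RX.Λ * RX.R) * ((RY.Λ * RY.R) * (RZ.Λ * RZ.R))    ≈⟨ *-cong RX.ΛR≈-1 (*-cong RY.ΛR≈-1 RZ.ΛR≈-1) ⟩
        - 1# * (- 1# * - 1#)                               ≈⟨ *-congˡ -1²≈1 ⟩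
        - 1# * 1#                                          ≈⟨ *-identityʳ _ ⟩
        - 1#                                               ∎

    -- rewrite each f_{D∪{p}}(s) as Λ f_{D∪{p}}(r) and collect the Λ's
    segre : (fS (L (D ∪ ⁅ x ⁆)) (a y) * fS (L (D ∪ ⁅ y ⁆)) (a z)) * fS (L (D ∪ ⁅ z ⁆)) (a x)
            ≈ negOnePow (suc t) * ((fS (L (D ∪ ⁅ y ⁆)) (a x) * fS (L (D ∪ ⁅ z ⁆)) (a y)) * fS (L (D ∪ ⁅ x ⁆)) (a z))
    segre = sym (begin
      N * ((fS (L (D ∪ ⁅ y ⁆)) (a x) * fS (L (D ∪ ⁅ z ⁆)) (a y)) * fS (L (D ∪ ⁅ x ⁆)) (a z))
                                                    ≈⟨ *-congˡ (*-cong (*-cong RY.fS-ratio RZ.fS-ratio) RX.fS-ratio) ⟩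
      N * ((RY.Λ * B * (RZ.Λ * C)) * (RX.Λ * A))    ≈⟨ ×-Solver.prove 7 lhs rhs (N ∷ RX.Λ ∷ RY.Λ ∷ RZ.Λ ∷ A ∷ B ∷ C ∷ []) ⟩
      (N * (RX.Λ * (RY.Λ * RZ.Λ))) * ((A * B) * C)  ≈⟨ *-congʳ (*-congˡ Λ-product) ⟩
      (N * N) * ((A * B) * C)                       ≈⟨ *-congʳ (negOnePow-square (suc t)) ⟩
      1# * ((A * B) * C)                            ≈⟨ *-identityˡ _ ⟩
      (A * B) * C                                   ∎)
      where
      N A B C : Carrier
      N = negOnePow (suc t)
      A = fS (L (D ∪ ⁅ x ⁆)) (a y)
      B = fS (L (D ∪ ⁅ y ⁆)) (a z)
      C = fS (L (D ∪ ⁅ z ⁆)) (a x)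
      open ×-Solver using (var; _⊕_)
      lhs rhs : ×-Solver.Expr 7
      lhs = var 0F ⊕ (((var 2F ⊕ var 5F) ⊕ (var 3F ⊕ var 6F)) ⊕ (var 1F ⊕ var 4F))
      rhs = (var 0F ⊕ (var 1F ⊕ (var 2F ⊕ var 3F))) ⊕ ((var 4F ⊕ var 5F) ⊕ var 6F)

  fS-vanishes-at-p : Fin t → ∀ {p} → p ∉ D → fS (L (D ∪ ⁅ p ⁆)) (a p) ≈ 0#
  fS-vanishes-at-p j {p} p∉D = prodF-zero _ j (proj₂ (proj₁ (proj₂ tangent) j p) (≡⇒∈∪⁅x⁆ D ≡.refl))
    where
    tangent : TangentForms a (D ∪ ⁅ p ⁆) (L (D ∪ ⁅ p ⁆))
    tangent = tangents (D ∪ ⁅ p ⁆) (≡.trans (∣∪⁅x⁆∣ D p p∉D) (≡.cong suc ∣D∣))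

  both-vanish : ∀ N {P Q R P′ Q′ R′} → P ≈ 0# ⊎ Q ≈ 0# ⊎ R ≈ 0# → P′ ≈ 0# ⊎ Q′ ≈ 0# ⊎ R′ ≈ 0# →
                (P * Q) * R ≈ N * ((P′ * Q′) * R′)
  both-vanish N lhs≈0 rhs≈0 = trans (product₃-zero lhs≈0) (sym (trans (*-congˡ (product₃-zero rhs≈0)) (zeroʳ N)))

  -- the identity for arbitrary x, y, z outside D when t ≥ 1: if two of them
  -- coincide, the same factor vanishes on both sides
  identity-with-tangents : Fin t → n +ℕ t +ℕ 1 ≡ q +ℕ k → ∀ x y z → x ∉ D → y ∉ D → z ∉ D →
    (fS (L (D ∪ ⁅ x ⁆)) (a y) * fS (L (D ∪ ⁅ y ⁆)) (a z)) * fS (L (D ∪ ⁅ z ⁆)) (a x)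
    ≈ negOnePow (suc t) * ((fS (L (D ∪ ⁅ y ⁆)) (a x) * fS (L (D ∪ ⁅ z ⁆)) (a y)) * fS (L (D ∪ ⁅ x ⁆)) (a z))
  identity-with-tangents j eqn x y z x∉D y∉D z∉D with x FinP.≟ y | y FinP.≟ z | x FinP.≟ z
  ... | yes ≡.refl | _ | _ = both-vanish _ (inj₁ (fS-vanishes-at-p j x∉D)) (inj₁ (fS-vanishes-at-p j x∉D))
  ... | no _ | yes ≡.refl | _ = both-vanish _ (inj₂ (inj₁ (fS-vanishes-at-p j y∉D))) (inj₂ (inj₁ (fS-vanishes-at-p j y∉D)))
  ... | no _ | no _ | yes ≡.refl = both-vanish _ (inj₂ (inj₂ (fS-vanishes-at-p j x∉D))) (inj₂ (inj₂ (fS-vanishes-at-p j x∉D)))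
  ... | no x≢y | no y≢z | no x≢z = ThreeRoles.segre eqn x y z (triple x≢y x≢z y≢z x∉D y∉D z∉D)

  -- when t = 0 there are n - (k - 3) = q + 2 ≥ 3 points outside D
  -- (q ≥ 1 since F contains 0)
  three-points-outside-D : n +ℕ 0 +ℕ 1 ≡ q +ℕ k → Σ (Fin n) λ x → Σ (Fin n) λ y → Σ (Fin n) λ z → Triple x y z
  three-points-outside-D eqn =
    f 0F , f 1F , f (suc (suc i)) , triple (distinct (λ ())) (distinct (λ ())) (distinct (λ ())) (f∉D 0F) (f∉D 1F) (f∉D _)
    where
    points : Elements (∁ D) (suc (suc q))
    points = elements-of-size (∁ D) (≡.trans (∣∁p∣≡n∸∣p∣ D) (≡.trans (≡.cong (n ∸_) ∣D∣) (size-outside-D q k₃ n eqn)))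
    f : Fin (suc (suc q)) → Fin n
    f = proj₁ points
    distinct : ∀ {i j} → i ≢ j → f i ≢ f j
    distinct i≢j = i≢j ∘ proj₁ (proj₂ points)
    f∉D : ∀ i → f i ∉ D
    f∉D i = x∈∁p⇒x∉p (proj₂ (proj₂ points) i)
    i : Fin q
    i = proj₁ (proj₂ (proj₂ card) 0#)

open import Data.Nat using (_+_)

mainTheorem1 : ∀ {c ℓ} (F : Field c ℓ) (q : ℕ) → PrimePower q → FieldDefs.HasCard F q →
    (k t n : ℕ) → 3 ≤ k → n + t + 1 ≡ q + k →
    (a : Fin n → FieldDefs.Vect F k) → FieldDefs.IsArc F a →
    (L : Subset n → Fin t → FieldDefs.Vect F k) →
    (∀ S → ∣ S ∣ ≡ k ∸ 2 → FieldDefs.TangentForms F a S (L S)) →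
    (D : Subset n) → ∣ D ∣ ≡ k ∸ 3 →
    (x y z : Fin n) → x ∉ D → y ∉ D → z ∉ D →
    let open Field F
        f = λ S v → FieldDefs.fS F (L S) v
    in (f (D ∪ ⁅ x ⁆) (a y) * f (D ∪ ⁅ y ⁆) (a z)) * f (D ∪ ⁅ z ⁆) (a x)
       ≈ FieldDefs.negOnePow F (suc t)
         * ((f (D ∪ ⁅ y ⁆) (a x) * f (D ∪ ⁅ z ⁆) (a y)) * f (D ∪ ⁅ x ⁆) (a z))
-- with a tangent, the identity holds for all x, y, z outside D
mainTheorem1 F q _ card (suc (suc (suc k₃))) (suc t) n (s≤s (s≤s (s≤s _))) eqn a arc L tangents D ∣D∣ x y z x∉D y∉D z∉D =
  Configuration.identity-with-tangents F q card k₃ (suc t) n a arc L tangents D ∣D∣ zero eqn x y z x∉D y∉D z∉D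
-- without tangents all f_S are 1 and the statement reads 1 = -1; this is
-- Segre's identity for any three distinct points outside D
mainTheorem1 F q _ card (suc (suc (suc k₃))) zero n (s≤s (s≤s (s≤s _))) eqn a arc L tangents D ∣D∣ _ _ _ _ _ _ =
  let (x , y , z , xyz) = three-points-outside-D eqn in ThreeRoles.segre eqn x y z xyz
  where open Configuration F q card k₃ zero n a arc L tangents D ∣D∣
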